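{- Let $\mathrm{L}$ be a relational $\lambda$-signature and $\mathsf B$ a $<\lambda$-complete Boolean algebra. Then for every $\mathsf B$-valued model $\mathcal M$ for $\mathrm{L}$, every $\mathrm{L}_{\infty\infty}$-formula $\phi(x_i:i<\alpha)$ with displayed free variables, and all sequences $(\sigma_i:i<\alpha),(\tau_i:i<\alpha)$ in $M^\alpha$, $$\Big(\bigwedge_{i<\alpha}[\![\tau_i=\sigma_i]\!]^{\mathcal M}\Big)\wedge[\![\phi(\tau_i:i<\alpha)]\!]^{\mathcal M}\le[\![\phi(\sigma_i:i<\alpha)]\!]^{\mathcal M},$$ all values computed in $\mathrm{RO}(\mathsf B^+)$.
   Context: A relational $\lambda$-signature has relation symbols of arities $<\lambda$ (possibly infinite) and constant symbols, no function symbols. $\mathrm{L}_{\infty\infty}$-formulae: closure of atomic formulae under $\neg$, set-sized $\bigwedge,\bigvee$, and $\forall V,\exists V$ for sets $V$ of variables. For $\mathsf B$ a $<\lambda$-complete Boolean algebra, $\mathrm{RO}(\mathsf B^+)$ is the complete Boolean algebra of regular open subsets of $\mathsf B^+$ in the topology of downward closed sets; $\mathsf B$ is identified with its dense image via $b\mapsto\{c\in\mathsf B^+:c\le b\}$. A $\mathsf B$-valued model $\mathcal M$ is a nonempty set $M$ with maps $[\![\tau=\sigma]\!]\in\mathsf B$, $[\![R(\tau_i:i<\beta)]\!]\in\mathsf B$ for each $\beta$-ary $R$, and interpretations of constants in $M$, such that $[\![\tau=\tau]\!]=1$, $[\![\tau=\sigma]\!]=[\![\sigma=\tau]\!]$,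 $[\![\tau=\sigma]\!]\wedge[\![\sigma=\pi]\!]\le[\![\tau=\pi]\!]$, and $\bigwedge_{i<\beta}[\![\tau_i=\sigma_i]\!]\wedge[\![R(\tau_i:i<\beta)]\!]\le[\![R(\sigma_i:i<\beta)]\!]$. Values of arbitrary formulae in $\mathrm{RO}(\mathsf B^+)$: atomic as given; $\neg$ complement; $\bigwedge,\bigvee$ infimum/supremum; $\forall V,\exists V$ infimum/supremum over all assignments $V\to M$. -}

module Defs where

open import Level using (0ℓ)
open import Data.Bool using (Bool; true; false; if_then_else_)
open import Data.Product using (Σ; _×_; _,_; proj₁)
open import Data.Sum using (_⊎_)
open import Relation.Binary.PropositionalEquality using (_≡_)
open import Relation.Nullary using (¬_)
open import Algebra.Lattice.Bundles using (BooleanAlgebra)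

-- The cardinal λ is represented by the class of index types of size < λ:
-- `Small I` means "I has cardinality < λ".

module BA (B : BooleanAlgebra 0ℓ 0ℓ) where
  open BooleanAlgebra B public renaming (¬_ to compl)

  _≤_ : Carrier → Carrier → Set
  x ≤ y = x ∧ y ≈ x

  Pos : Carrier → Set
  Pos b = ¬ (b ≈ ⊥)

-- B is <λ-complete: every family of size < λ has an infimum
-- (suprema then exist by complementation).
record LtComplete (Small : Set → Set) (B : BooleanAlgebra 0ℓ 0ℓ) : Set₁ where
  open BA B
  field
    ⋀ : (I : Set) → Small I → (I → Carrier) → Carrier
    ⋀-lb : ∀ I (sI : Small I) (f : I → Carrier) i → ⋀ I sI f ≤ f i
    ⋀-glb : ∀ I (sI : Small I) (f : I → Carrier) (b : Carrier) →
            (∀ i → b ≤ f i) → b ≤ ⋀ I sI f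

-- Subsets of B⁺ and the operations of RO(B⁺) (topology of downward
-- closed subsets of B⁺).  A subset of B⁺ is a predicate on Carrier,
-- only consulted on positive elements.

module RO (B : BooleanAlgebra 0ℓ 0ℓ) where
  open BA B

  SubB⁺ : Set₁
  SubB⁺ = Carrier → Set

  ↓ : Carrier → SubB⁺
  ↓ b c = c ≤ b

  ∁ : SubB⁺ → SubB⁺
  ∁ U b = ∀ c → Pos c → c ≤ b → ¬ U c

  ⋂ : (I : Set) → (I → SubB⁺) → SubB⁺
  ⋂ I U b = ∀ i → U i b

  _⊓_ : SubB⁺ → SubB⁺ → SubB⁺
  (U ⊓ V) b = U b × V b

  -- supremum in RO(B⁺):  int(cl(⋃ U)),  where cl A = upward closure of A
  -- and int A = {b : every positive c ≤ b lies in A}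
  ⋃ : (I : Set) → (I → SubB⁺) → SubB⁺
  ⋃ I U b = ∀ c → Pos c → c ≤ b →
            Σ I λ i → Σ Carrier λ d → Pos d × d ≤ c × U i d

  _⊑_ : SubB⁺ → SubB⁺ → Set
  U ⊑ V = ∀ b → Pos b → U b → V b

record Signature (Small : Set → Set) : Set₁ where
  field
    Rel     : Set
    Ar      : Rel → Set
    ar<λ    : ∀ R → Small (Ar R)
    Const   : Set

-- L∞∞ formulae over a set Var of variables.  Sets of variables are
-- given by characteristic functions Var → Bool.

module Syntax {Small : Set → Set} (L : Signature Small) (Var : Set) where
  open Signature L

  data Term : Set where
    var : Var → Term
    con : Const → Term

  data Formula : Set₁ where
    _≐_  : Term → Term → Formula
    rel  : (R : Rel) → (Ar R → Term) → Formula
    neg  : Formula → Formula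
    conj : (I : Set) → (I → Formula) → Formula
    disj : (I : Set) → (I → Formula) → Formula
    all  : (Var → Bool) → Formula → Formula
    ex   : (Var → Bool) → Formula → Formula

  data Free (v : Var) : Formula → Set₁ where
    ≐ˡ   : ∀ {t} → Free v (var v ≐ t)
    ≐ʳ   : ∀ {t} → Free v (t ≐ var v)
    rel' : ∀ {R ts} i → ts i ≡ var v → Free v (rel R ts)
    neg' : ∀ {φ} → Free v φ → Free v (neg φ)
    conj' : ∀ {I φs} i → Free v (φs i) → Free v (conj I φs)
    disj' : ∀ {I φs} i → Free v (φs i) → Free v (disj I φs)
    all' : ∀ {V φ} → V v ≡ false → Free v φ → Free v (all V φ)
    ex'  : ∀ {V φ} → V v ≡ false → Free v φ → Free v (ex V φ)

record BVModel {Small : Set → Set} (B : BooleanAlgebra 0ℓ 0ℓ)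
               (C : LtComplete Small B) (L : Signature Small) : Set₁ where
  open BA B
  open LtComplete C
  open Signature L
  field
    M      : Set
    inhab  : M
    ⟦_≐_⟧  : M → M → Carrier
    ⟦rel⟧  : (R : Rel) → (Ar R → M) → Carrier
    cst    : Const → M
    ≐-refl  : ∀ a → ⟦ a ≐ a ⟧ ≈ ⊤
    ≐-sym   : ∀ a b → ⟦ a ≐ b ⟧ ≈ ⟦ b ≐ a ⟧
    ≐-trans : ∀ a b c → (⟦ a ≐ b ⟧ ∧ ⟦ b ≐ c ⟧) ≤ ⟦ a ≐ c ⟧
    rel-cong : ∀ R (τ σ : Ar R → M) →
               (⋀ (Ar R) (ar<λ R) (λ i → ⟦ τ i ≐ σ i ⟧) ∧ ⟦rel⟧ R τ) ≤ ⟦rel⟧ R σ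

module Semantics {Small : Set → Set} {B : BooleanAlgebra 0ℓ 0ℓ}
                 {C : LtComplete Small B} {L : Signature Small}
                 (𝓜 : BVModel B C L) (Var : Set) where
  open BA B
  open RO B
  open BVModel 𝓜
  open Syntax L Var

  term : (Var → M) → Term → M
  term s (var v) = s v
  term s (con c) = cst c

  Variant : (Var → Bool) → (Var → M) → Set
  Variant V s = Σ (Var → M) λ s' → ∀ v → V v ≡ false → s' v ≡ s v

  val : Formula → (Var → M) → SubB⁺
  val (t ≐ u) s = ↓ ⟦ term s t ≐ term s u ⟧
  val (rel R ts) s = ↓ (⟦rel⟧ R (λ i → term s (ts i)))
  val (neg φ) s = ∁ (val φ s)
  val (conj I φs) s = ⋂ I (λ i → val (φs i) s)
  val (disj I φs) s = ⋃ I (λ i → val (φs i) s)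
  val (all V φ) s = ⋂ (Variant V s) (λ p → val φ (proj₁ p))
  val (ex V φ) s = ⋃ (Variant V s) (λ p → val φ (proj₁ p))

{-# OPTIONS --safe #-}
-- Induction on φ, simultaneously for all pairs of assignments and all b, of:
-- if b ≤ ⟦ s v ≐ t v ⟧ for every free v of φ, then b ∈ ⟦ φ ⟧ s implies b ∈ ⟦ φ ⟧ t.
-- Negation swaps s and t and passes to smaller c ≤ b, which is why the claim
-- is made for all pairs and all b.  For a quantifier over V, a V-variant of
-- one assignment is matched by the other assignment overridden on V by it:
-- the two then agree on V and are still close off V.
module Submission where

open import Defs
open import Level using (0ℓ)
open import Data.Bool using (Bool; true; false)
open import Data.Product using (Σ; _,_; proj₁)
open import Relation.Binary.PropositionalEquality using (_≡_; refl)
open import Algebra.Lattice.Bundles using (BooleanAlgebra)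
open import Relation.Binary.Lattice.Structures using (IsLattice)
import Algebra.Lattice.Properties.Lattice as LatticeProperties
import Algebra.Lattice.Properties.BooleanAlgebra as BooleanAlgebraProperties

module BooleanOrder (B : BooleanAlgebra 0ℓ 0ℓ) where
  open BA B

  -- The library orders a lattice by x ≈ x ∧ y, the mirror image of _≤_.
  private
    module ≤ₗ = IsLattice (LatticeProperties.∨-∧-isOrderTheoreticLattice lattice)

  ≤-trans : ∀ {x y z} → x ≤ y → y ≤ z → x ≤ z
  ≤-trans x≤y y≤z = sym (≤ₗ.trans (sym x≤y) (sym y≤z))

  ≤-respʳ-≈ : ∀ {x y z} → y ≈ z → x ≤ y → x ≤ z
  ≤-respʳ-≈ y≈z x≤y = sym (≤ₗ.≤-respʳ-≈ y≈z (sym x≤y))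

  ∧-greatest : ∀ {x y z} → x ≤ y → x ≤ z → x ≤ (y ∧ z)
  ∧-greatest x≤y x≤z = sym (≤ₗ.∧-greatest (sym x≤y) (sym x≤z))

  ≤-maximum : ∀ {x y} → y ≈ ⊤ → x ≤ y
  ≤-maximum {x} y≈⊤ = ≤-respʳ-≈ (sym y≈⊤) (BooleanAlgebraProperties.∧-identityʳ B x)

module Substitution {Small : Set → Set} {L : Signature Small}
  {B : BooleanAlgebra 0ℓ 0ℓ} {C : LtComplete Small B}
  (𝓜 : BVModel B C L) (Var : Set) where
  open BA B using (Carrier; _≤_)
  open BooleanOrder B
  open LtComplete C
  open BVModel 𝓜
  open Signature L
  open Syntax L Var
  open Semantics 𝓜 Var

  _⊩_≐_ : Carrier → M → M → Set
  b ⊩ a ≐ a′ = b ≤ ⟦ a ≐ a′ ⟧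

  ⊩-refl : ∀ {b} a → b ⊩ a ≐ a
  ⊩-refl a = ≤-maximum (≐-refl a)

  ⊩-sym : ∀ {b a a′} → b ⊩ a ≐ a′ → b ⊩ a′ ≐ a
  ⊩-sym {a = a} {a′} = ≤-respʳ-≈ (≐-sym a a′)

  ⊩-trans : ∀ {b a a′ a″} → b ⊩ a ≐ a′ → b ⊩ a′ ≐ a″ → b ⊩ a ≐ a″
  ⊩-trans {a = a} {a′} {a″} p q = ≤-trans (∧-greatest p q) (≐-trans a a′ a″)

  term-cong : ∀ {b} (s t : Var → M) (u : Term) →
              (∀ v → u ≡ var v → b ⊩ s v ≐ t v) → b ⊩ term s u ≐ term t u
  term-cong s t (var v) close = close v refl
  term-cong s t (con c) close = ⊩-refl (cst c)

  _⊩_≐_on_ : Carrier → (Var → M) → (Var → M) → Formula → Set₁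
  b ⊩ s ≐ t on φ = ∀ v → Free v φ → b ⊩ s v ≐ t v

  on-sym : ∀ {b s t} φ → b ⊩ s ≐ t on φ → b ⊩ t ≐ s on φ
  on-sym φ close v free = ⊩-sym (close v free)

  on-antitone : ∀ {b c s t} φ → c ≤ b → b ⊩ s ≐ t on φ → c ⊩ s ≐ t on φ
  on-antitone φ c≤b close v free = ≤-trans c≤b (close v free)

  override : (Var → Bool) → (Var → M) → (Var → M) → Var → M
  override V s s′ v with V v
  ... | true  = s′ v
  ... | false = s v

  override-variant : ∀ V s s′ → Variant V s
  override-variant V s s′ = override V s s′ , agrees-off
    where
    agrees-off : ∀ v → V v ≡ false → override V s s′ v ≡ s v
    agrees-off v off with V v
    agrees-off v refl | false = refl

  override-close : ∀ {b} V φ s t (t′ : Variant V t) →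
                   (∀ v → V v ≡ false → Free v φ → b ⊩ s v ≐ t v) →
                   b ⊩ override V s (proj₁ t′) ≐ proj₁ t′ on φ
  override-close V φ s t (t′ , t′≡t) close v free with V v in Vv
  ... | true  = ⊩-refl (t′ v)
  ... | false rewrite t′≡t v Vv = close v Vv free

  val-cong : ∀ φ {b s t} → b ⊩ s ≐ t on φ → val φ s b → val φ t b
  val-cong (u ≐ w) {s = s} {t} close s⊩u≐w =
    ⊩-trans (⊩-sym (term-cong s t u λ { v refl → close v ≐ˡ }))
      (⊩-trans s⊩u≐w (term-cong s t w λ { v refl → close v ≐ʳ }))
  val-cong (rel R us) {b} {s} {t} close s⊩R =
    ≤-trans (∧-greatest (⋀-glb (Ar R) (ar<λ R) _ b arguments-close) s⊩R)
            (rel-cong R _ _)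
    where
    arguments-close : ∀ i → b ⊩ term s (us i) ≐ term t (us i)
    arguments-close i = term-cong s t (us i) λ v us≡v → close v (rel' i us≡v)
  val-cong (neg φ) close s∉φ c c>0 c≤b t∈φ =
    s∉φ c c>0 c≤b
      (val-cong φ (on-antitone φ c≤b (on-sym φ λ v free → close v (neg' free))) t∈φ)
  val-cong (conj I φs) close s∈φs i = val-cong (φs i) (λ v free → close v (conj' i free)) (s∈φs i)
  val-cong (disj I φs) close s∈⋃ c c>0 c≤b with s∈⋃ c c>0 c≤b
  ... | i , d , d>0 , d≤c , s∈φ =
    i , d , d>0 , d≤c ,
    val-cong (φs i) (on-antitone (φs i) (≤-trans d≤c c≤b) λ v free → close v (disj' i free)) s∈φ
  val-cong (all V φ) {s = s} {t} close s∈∀ t′ =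
    val-cong φ (override-close V φ s t t′ λ v off free → close v (all' off free))
      (s∈∀ (override-variant V s (proj₁ t′)))
  val-cong (ex V φ) {s = s} {t} close s∈∃ c c>0 c≤b with s∈∃ c c>0 c≤b
  ... | s′ , d , d>0 , d≤c , s′∈φ =
    override-variant V t (proj₁ s′) , d , d>0 , d≤c ,
    val-cong φ
      (on-sym φ (override-close V φ t s s′ λ v off free →
        ⊩-sym (≤-trans (≤-trans d≤c c≤b) (close v (ex' off free)))))
      s′∈φ

fact2p6 : (Small : Set → Set) (L : Signature Small)
    (B : BooleanAlgebra 0ℓ 0ℓ) (C : LtComplete Small B)
    (𝓜 : BVModel B C L) (Var : Set)
    (φ : Syntax.Formula L Var)
    (α : Set) (x : α → Var) → (∀ i j → x i ≡ x j → i ≡ j) →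
    (∀ v → Syntax.Free L Var v φ → Σ α (λ i → x i ≡ v)) →
    (τ σ : α → BVModel.M 𝓜) (s t : Var → BVModel.M 𝓜) →
    (∀ i → s (x i) ≡ τ i) → (∀ i → t (x i) ≡ σ i) →
    RO._⊑_ B
      (RO._⊓_ B (RO.⋂ B α (λ i → RO.↓ B (BVModel.⟦_≐_⟧ 𝓜 (τ i) (σ i))))
                (Semantics.val 𝓜 Var φ s))
      (Semantics.val 𝓜 Var φ t)
fact2p6 Small L B C 𝓜 Var φ α x _ free⇒x τ σ s t s∘x≡τ t∘x≡σ b _ (b≤τ≐σ , s∈φ) =
  val-cong φ close s∈φ
  where
  open Substitution 𝓜 Var
  close : b ⊩ s ≐ t on φ
  close v free with free⇒x v free
  ... | i , refl rewrite s∘x≡τ i | t∘x≡σ i = b≤τ≐σ i
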